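{- Let $\Gamma=(V,E)$ be a graph with no isolated vertices and constant edge-multiplicity $\lambda$, and let $G\leq\mathrm{Aut}\,\Gamma$ be transitive on $E$ with exactly two orbits $V_1,V_2$ on $V$. Then either (a) $\Gamma\cong\mathrm{BiCos}(G,L,R,J)$ where, for some edge $e$ with ends $\alpha,\beta$, the subgroups $L,R,J$ are the stabilisers in $G$ of $\alpha,\beta,e$ respectively, and $|L\cap R:J|=\lambda$; or (b) $\Gamma\cong r\mathbf{K}_2^{(\lambda)}$, where $r=|V_1|=|V_2|$.
   Context: Graphs are finite, loopless, possibly with multiple edges; automorphisms permute $V\cup E$ preserving $V$, $E$ and incidence. Constant edge-multiplicity $\lambda$: any two adjacent vertices are joined by exactly $\lambda$ edges. $r\mathbf{K}_2^{(\lambda)}$ is the disjoint union of $r$ copies of the graph with two vertices joined by $\lambda$ edges. For subgroups $L\neq R$, $J\leq L\cap R$ of $G$, $\mathrm{BiCos}(G,L,R,J)$ has vertex set $[G:L]\cup[G:R]$ (right cosets), edge set $[G:J]$, and $Lx$ (resp. $Rx$) incident with $Jy$ iff $Lx\cap Jy\ne\emptyset$ (resp. $Rx\cap Jy\neq\emptyset$). -}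

module Defs where

open import Level using (Level; _⊔_) renaming (zero to 0ℓ; suc to lsuc)
open import Data.Nat using (ℕ)
open import Data.Fin using (Fin) renaming (_≟_ to _≟F_)
open import Data.Fin.Base using ()
open import Data.List using (List; length; filter)
open import Data.List.Base using ()
open import Data.Fin using ()
open import Data.List using ()
open import Data.Product using (Σ; ∃; ∃-syntax; _×_; _,_; proj₁; proj₂)
open import Data.Sum using (_⊎_; inj₁; inj₂)
open import Data.Empty using (⊥)
open import Relation.Nullary using (¬_; Dec)
open import Relation.Nullary.Decidable using (_×-dec_; _⊎-dec_)
open import Relation.Binary.PropositionalEquality using (_≡_; _≢_)
open import Algebra.Bundles using (Group)

import Data.List as L
open import Data.Fin.Base using () renaming ()

allFin : (n : ℕ) → List (Fin n)
allFin n = L.allFin n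

record Graph : Set where
  field
    nV nE    : ℕ
    ends     : Fin nE → Fin nV × Fin nV
    loopless : ∀ e → proj₁ (ends e) ≢ proj₂ (ends e)

  Inc : Fin nV → Fin nE → Set
  Inc v e = (v ≡ proj₁ (ends e)) ⊎ (v ≡ proj₂ (ends e))

  Joins : Fin nV → Fin nV → Fin nE → Set
  Joins u v e = ((u ≡ proj₁ (ends e)) × (v ≡ proj₂ (ends e)))
              ⊎ ((u ≡ proj₂ (ends e)) × (v ≡ proj₁ (ends e)))

  joins? : (u v : Fin nV) (e : Fin nE) → Dec (Joins u v e)
  joins? u v e = ((u ≟F proj₁ (ends e)) ×-dec (v ≟F proj₂ (ends e)))
            ⊎-dec ((u ≟F proj₂ (ends e)) ×-dec (v ≟F proj₁ (ends e)))

  multiplicity : Fin nV → Fin nV → ℕ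
  multiplicity u v = length (filter (joins? u v) (allFin nE))

  Adjacent : Fin nV → Fin nV → Set
  Adjacent u v = ∃[ e ] Joins u v e

  NoIsolatedVertices : Set
  NoIsolatedVertices = ∀ v → ∃[ e ] Inc v e

  ConstantEdgeMultiplicity : ℕ → Set
  ConstantEdgeMultiplicity μ = ∀ u v → Adjacent u v → multiplicity u v ≡ μ

-- A group G ≤ Aut Γ: a group acting faithfully (on the right) on Γ by
-- automorphisms, i.e. acting on V and on E preserving incidence.

record AutAction {c ℓ : Level} (Γ : Graph) (G : Group c ℓ) : Set (c ⊔ ℓ) where
  open Graph Γ
  open Group G
  field
    actV     : Carrier → Fin nV → Fin nV
    actE     : Carrier → Fin nE → Fin nE
    actV-ε   : ∀ v → actV ε v ≡ v
    actE-ε   : ∀ e → actE ε e ≡ e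
    actV-∙   : ∀ g h v → actV (g ∙ h) v ≡ actV h (actV g v)
    actE-∙   : ∀ g h e → actE (g ∙ h) e ≡ actE h (actE g e)
    actV-cong : ∀ {g h} → g ≈ h → ∀ v → actV g v ≡ actV h v
    actE-cong : ∀ {g h} → g ≈ h → ∀ e → actE g e ≡ actE h e
    inc-pres  : ∀ g v e → Inc v e → Inc (actV g v) (actE g e)
    inc-refl  : ∀ g v e → Inc (actV g v) (actE g e) → Inc v e
    faithful  : ∀ g → (∀ v → actV g v ≡ v) → (∀ e → actE g e ≡ e) → g ≈ ε

  EdgeTransitive : Set c
  EdgeTransitive = ∀ e e′ → ∃[ g ] actE g e ≡ e′

  Orb : Fin nV → Fin nV → Set c
  Orb α v = ∃[ g ] actV g α ≡ v

  StabV : Fin nV → Carrier → Set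
  StabV α g = actV g α ≡ α

  StabE : Fin nE → Carrier → Set
  StabE e g = actE g e ≡ e

HasSize : {n : ℕ} {p : Level} → (Fin n → Set p) → ℕ → Set p
HasSize {n} P r =
  Σ (Fin r → Fin n) λ f →
    (∀ i → P (f i)) × (∀ i j → f i ≡ f j → i ≡ j) × (∀ v → P v → ∃[ i ] f i ≡ v)

-- Graphs whose vertex and edge sets are setoids (for coset graphs)

record SGraph (a b : Level) : Set (lsuc (a ⊔ b)) where
  field
    V    : Set a
    E    : Set a
    _≈V_ : V → V → Set b
    _≈E_ : E → E → Set b
    Inc  : V → E → Set b

record _≅_ {a b : Level} (Γ : Graph) (S : SGraph a b) : Set (a ⊔ b) where
  open Graph Γ
  module S = SGraph S
  field
    fV      : Fin nV → S.V
    fE      : Fin nE → S.E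
    fV-inj  : ∀ u v → S._≈V_ (fV u) (fV v) → u ≡ v
    fE-inj  : ∀ e e′ → S._≈E_ (fE e) (fE e′) → e ≡ e′
    fV-surj : ∀ x → ∃[ v ] S._≈V_ (fV v) x
    fE-surj : ∀ y → ∃[ e ] S._≈E_ (fE e) y
    inc→    : ∀ v e → Inc v e → S.Inc (fV v) (fE e)
    inc←    : ∀ v e → S.Inc (fV v) (fE e) → Inc v e

-- The bi-coset graph BiCos(G, L, R, J) (right cosets).
-- Vertices: [G:L] ⊔ [G:R], edges: [G:J];
-- Lx ~ Ly iff x y⁻¹ ∈ L, and Lx incident with Jy iff Lx ∩ Jy ≠ ∅.

module _ {c ℓ : Level} (G : Group c ℓ) where
  open Group G

  BiCos : (L R J : Carrier → Set) → SGraph c (c ⊔ ℓ)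
  BiCos L R J = record
    { V = Carrier ⊎ Carrier
    ; E = Carrier
    ; _≈V_ = eqV
    ; _≈E_ = λ x y → Lift′ (J (x ∙ y ⁻¹))
    ; Inc = inc
    }
    where
      open import Level using (Lift; lift)
      Lift′ : Set → Set (c ⊔ ℓ)
      Lift′ A = Lift (c ⊔ ℓ) A
      eqV : Carrier ⊎ Carrier → Carrier ⊎ Carrier → Set (c ⊔ ℓ)
      eqV (inj₁ x) (inj₁ y) = Lift′ (L (x ∙ y ⁻¹))
      eqV (inj₂ x) (inj₂ y) = Lift′ (R (x ∙ y ⁻¹))
      eqV (inj₁ _) (inj₂ _) = Lift′ ⊥
      eqV (inj₂ _) (inj₁ _) = Lift′ ⊥
      inc : Carrier ⊎ Carrier → Carrier → Set (c ⊔ ℓ)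
      inc (inj₁ x) y = Lift (c ⊔ ℓ) (∃[ g ] (L (g ∙ x ⁻¹) × J (g ∙ y ⁻¹)))
      inc (inj₂ x) y = Lift (c ⊔ ℓ) (∃[ g ] (R (g ∙ x ⁻¹) × J (g ∙ y ⁻¹)))

  -- |L ∩ R : J| = n : there are exactly n right cosets of J contained in L ∩ R
  IndexInIntersection : (L R J : Carrier → Set) → ℕ → Set c
  IndexInIntersection L R J n =
    Σ (Fin n → Carrier) λ f →
      (∀ i → L (f i) × R (f i))
      × (∀ i j → J (f i ∙ f j ⁻¹) → i ≡ j)
      × (∀ g → L g → R g → ∃[ i ] J (g ∙ f i ⁻¹))

-- r K₂^(μ): r disjoint copies of two vertices joined by μ edges.
-- Vertices (i , b), edges (i , k); (i , b) incident with (j , k) iff i ≡ j.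

rK2 : ℕ → ℕ → SGraph 0ℓ 0ℓ
rK2 r μ = record
  { V = Fin r × Fin 2
  ; E = Fin r × Fin μ
  ; _≈V_ = _≡_
  ; _≈E_ = _≡_
  ; Inc = λ v e → proj₁ v ≡ proj₁ e
  }

-- Every edge has one end in each vertex orbit.  Fix an edge e₀ with ends α ∈ V₁ and
-- β ∈ V₂; by edge-transitivity every edge is g e₀ with ends g α and g β, so
-- g G_α ↦ g α, g G_β ↦ g β and g G_{e₀} ↦ g e₀ identify Γ with BiCos(G, G_α, G_β, G_{e₀}),
-- and the λ edges joining α and β are the G_{e₀}-cosets inside G_α ∩ G_β.  This is (a)
-- unless G_α = G_β.  In that case the β-end of an edge is determined by its α-end, so
-- each vertex lies on a single class of parallel edges: Γ is a perfect matching of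
-- λ-fold edges, whose components are indexed by V₁ (and equally by V₂).
module Submission where

open import Defs
open import Level using (Level; lift)
open import Data.Nat using (ℕ)
open import Data.Fin using (Fin; zero; suc; _≟_)
open import Data.Fin.Properties using (all?)
open import Data.Product using (Σ; ∃; ∃-syntax; _×_; _,_; proj₁; proj₂)
open import Data.Sum using (_⊎_; inj₁; inj₂)
import Data.Sum as Sum
open import Data.Empty using (⊥; ⊥-elim)
open import Data.List using (List; length; filter; lookup)
import Data.List as List
import Data.List.Relation.Unary.All as All
open import Data.List.Relation.Unary.AllPairs using (_∷_)
open import Data.List.Relation.Unary.Unique.Propositional using (Unique)
import Data.List.Relation.Unary.Unique.Propositional.Properties as Unique
open import Data.List.Membership.Propositional.Properties
  using (∈-filter⁺; ∈-filter⁻; ∈-lookup; ∈-allFin)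
open import Data.List.Relation.Unary.Any using (index)
open import Data.List.Relation.Unary.Any.Properties using (lookup-index)
open import Function using (_∘_; case_of_)
open import Relation.Nullary using (¬_; Dec; yes; no)
open import Relation.Nullary.Decidable using (_×-dec_; _→-dec_; map′)
open import Relation.Unary using (Decidable)
open import Relation.Binary.PropositionalEquality
  using (_≡_; _≢_; refl; sym; trans; cong; subst; subst₂; module ≡-Reasoning)
open import Algebra.Bundles using (Group)

lookup-injective : ∀ {A : Set} {xs : List A} → Unique xs →
                   ∀ i j → lookup xs i ≡ lookup xs j → i ≡ j
lookup-injective (_ ∷ _)       zero    zero    _  = refl
lookup-injective (x∉xs ∷ _)    zero    (suc j) eq = ⊥-elim (All.lookup x∉xs (∈-lookup j) eq)
lookup-injective (x∉xs ∷ _)    (suc i) zero    eq = ⊥-elim (All.lookup x∉xs (∈-lookup i) (sym eq))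
lookup-injective (_ ∷ unique) (suc i) (suc j) eq = cong suc (lookup-injective unique i j eq)

hasSize-filter : ∀ {n p} {P : Fin n → Set p} (P? : Decidable P) →
                 HasSize P (length (filter P? (List.allFin n)))
hasSize-filter {n} P? =
  lookup xs ,
  (λ i → proj₂ (∈-filter⁻ P? {xs = List.allFin n} (∈-lookup i))) ,
  lookup-injective (Unique.filter⁺ P? (Unique.allFin⁺ n)) ,
  λ x px → let x∈xs = ∈-filter⁺ P? (∈-allFin x) px in index x∈xs , sym (lookup-index x∈xs)
  where xs = filter P? (List.allFin n)

hasSize-⇔ : ∀ {n r p q} {P : Fin n → Set p} {Q : Fin n → Set q} →
            (∀ x → P x → Q x) → (∀ x → Q x → P x) → HasSize P r → HasSize Q r
hasSize-⇔ P⇒Q Q⇒P (f , f∈P , f-injective , f-onto) =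
  f , (λ i → P⇒Q _ (f∈P i)) , f-injective , λ x qx → f-onto x (Q⇒P x qx)

hasSize-section : ∀ {n r p} {P : Fin n → Set p} (s : Fin r → Fin n) (c : Fin n → Fin r) →
                  (∀ i → P (s i)) → (∀ i → c (s i) ≡ i) → (∀ x → P x → s (c x) ≡ x) →
                  HasSize P r
hasSize-section s c s∈P c∘s s∘c =
  s , s∈P , (λ i j eq → trans (sym (c∘s i)) (trans (cong c eq) (c∘s j))) , λ x px → c x , s∘c x px

record ProductCoordinates {n r : ℕ} (p : Fin n → Fin r) (m : ℕ) : Set where
  field
    coord            : Fin n → Fin r × Fin m
    coord-fibre      : ∀ x → proj₁ (coord x) ≡ p x
    coord-injective  : ∀ x y → coord x ≡ coord y → x ≡ y
    coord-surjective : ∀ z → ∃[ x ] coord x ≡ z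

fibres⇒product : ∀ {n r m} (p : Fin n → Fin r) →
                 (∀ i → HasSize (λ x → p x ≡ i) m) → ProductCoordinates p m
fibres⇒product {n} {r} {m} p fibre = record
  { coord            = coord
  ; coord-fibre      = λ _ → refl
  ; coord-injective  = λ x y eq → trans (sym (enum-coord x)) (trans (cong enum eq) (enum-coord y))
  ; coord-surjective = λ z → enum z , enum-injective (coord (enum z)) z (enum-coord (enum z))
  }
  where
    enum : Fin r × Fin m → Fin n
    enum (i , k) = proj₁ (fibre i) k

    coord : Fin n → Fin r × Fin m
    coord x = p x , proj₁ (proj₂ (proj₂ (proj₂ (fibre (p x)))) x refl)

    enum-coord : ∀ x → enum (coord x) ≡ x
    enum-coord x = proj₂ (proj₂ (proj₂ (proj₂ (fibre (p x)))) x refl)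

    enum-fibre : ∀ i k → p (enum (i , k)) ≡ i
    enum-fibre i = proj₁ (proj₂ (fibre i))

    enum-injective : ∀ z z′ → enum z ≡ enum z′ → z ≡ z′
    enum-injective (i , k) (j , l) eq
      with trans (sym (enum-fibre i k)) (trans (cong p eq) (enum-fibre j l))
    ... | refl = cong (i ,_) (proj₁ (proj₂ (proj₂ (fibre i))) k l eq)

module RightAction {c ℓ : Level} (G : Group c ℓ) {X : Set}
  (act      : Group.Carrier G → X → X)
  (act-ε    : ∀ x → act (Group.ε G) x ≡ x)
  (act-∙    : ∀ g h x → act (Group._∙_ G g h) x ≡ act h (act g x))
  (act-cong : ∀ {g h} → Group._≈_ G g h → ∀ x → act g x ≡ act h x) where
  open Group G using (_∙_; _⁻¹; inverseˡ; inverseʳ)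
  open ≡-Reasoning

  act-⁻¹-act : ∀ g x → act (g ⁻¹) (act g x) ≡ x
  act-⁻¹-act g x = begin
    act (g ⁻¹) (act g x) ≡⟨ act-∙ g (g ⁻¹) x ⟨
    act (g ∙ g ⁻¹) x     ≡⟨ act-cong (inverseʳ g) x ⟩
    act _ x              ≡⟨ act-ε x ⟩
    x                    ∎

  act-act-⁻¹ : ∀ g x → act g (act (g ⁻¹) x) ≡ x
  act-act-⁻¹ g x = begin
    act g (act (g ⁻¹) x) ≡⟨ act-∙ (g ⁻¹) g x ⟨
    act (g ⁻¹ ∙ g) x     ≡⟨ act-cong (inverseˡ g) x ⟩
    act _ x              ≡⟨ act-ε x ⟩
    x                    ∎

  fixes⇒agree : ∀ a b x → act (a ∙ b ⁻¹) x ≡ x → act a x ≡ act b x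
  fixes⇒agree a b x fixes = begin
    act a x                       ≡⟨ act-act-⁻¹ b (act a x) ⟨
    act b (act (b ⁻¹) (act a x))  ≡⟨ cong (act b) (act-∙ a (b ⁻¹) x) ⟨
    act b (act (a ∙ b ⁻¹) x)      ≡⟨ cong (act b) fixes ⟩
    act b x                       ∎

  agree⇒fixes : ∀ a b x → act a x ≡ act b x → act (a ∙ b ⁻¹) x ≡ x
  agree⇒fixes a b x agree = begin
    act (a ∙ b ⁻¹) x      ≡⟨ act-∙ a (b ⁻¹) x ⟩
    act (b ⁻¹) (act a x)  ≡⟨ cong (act (b ⁻¹)) agree ⟩
    act (b ⁻¹) (act b x)  ≡⟨ act-⁻¹-act b x ⟩
    x                     ∎

module GraphProperties (Γ : Graph) where
  open Graph Γ

  joins⇒incˡ : ∀ {u w e} → Joins u w e → Inc u e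
  joins⇒incˡ (inj₁ (u≡ , _)) = inj₁ u≡
  joins⇒incˡ (inj₂ (u≡ , _)) = inj₂ u≡

  joins⇒incʳ : ∀ {u w e} → Joins u w e → Inc w e
  joins⇒incʳ (inj₁ (_ , w≡)) = inj₂ w≡
  joins⇒incʳ (inj₂ (_ , w≡)) = inj₁ w≡

  incident⇒joins : ∀ {u w e} → Inc u e → Inc w e → u ≢ w → Joins u w e
  incident⇒joins (inj₁ u≡) (inj₁ w≡) u≢w = ⊥-elim (u≢w (trans u≡ (sym w≡)))
  incident⇒joins (inj₁ u≡) (inj₂ w≡) _   = inj₁ (u≡ , w≡)
  incident⇒joins (inj₂ u≡) (inj₁ w≡) _   = inj₂ (u≡ , w≡)
  incident⇒joins (inj₂ u≡) (inj₂ w≡) u≢w = ⊥-elim (u≢w (trans u≡ (sym w≡)))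

  other-end : ∀ {v e} → Inc v e →
              Σ (Fin nV) λ w → Inc w e × v ≢ w × (∀ u → Inc u e → u ≡ v ⊎ u ≡ w)
  other-end {e = e} (inj₁ v≡) =
    proj₂ (ends e) , inj₂ refl , (λ v≡w → loopless e (trans (sym v≡) v≡w)) ,
    λ { u (inj₁ u≡) → inj₁ (trans u≡ (sym v≡)) ; u (inj₂ u≡) → inj₂ u≡ }
  other-end {e = e} (inj₂ v≡) =
    proj₁ (ends e) , inj₁ refl , (λ v≡w → loopless e (trans (sym v≡w) v≡)) ,
    λ { u (inj₁ u≡) → inj₂ u≡ ; u (inj₂ u≡) → inj₁ (trans u≡ (sym v≡)) }

  joining-edges : ∀ {μ} → ConstantEdgeMultiplicity μ →
                  ∀ {u w} → Adjacent u w → HasSize (Joins u w) μ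
  joining-edges constant {u} {w} adjacent =
    subst (HasSize (Joins u w)) (constant u w adjacent) (hasSize-filter (joins? u w))

module Orbits {c ℓ : Level} {Γ : Graph} {G : Group c ℓ} (A : AutAction Γ G) where
  open Graph Γ
  open Group G using (_∙_; _⁻¹; ε)
  open AutAction A

  module V = RightAction G actV actV-ε actV-∙ actV-cong
  module E = RightAction G actE actE-ε actE-∙ actE-cong

  orb-refl : ∀ a → Orb a a
  orb-refl a = ε , actV-ε a

  orb-sym : ∀ {a v} → Orb a v → Orb v a
  orb-sym {a} (g , refl) = g ⁻¹ , V.act-⁻¹-act g a

  orb-trans : ∀ {a b v} → Orb a b → Orb b v → Orb a v
  orb-trans {a} (g , refl) (h , refl) = g ∙ h , actV-∙ g h a

  inc-pres⁻¹ : ∀ g {v e} → Inc v (actE g e) → Inc (actV (g ⁻¹) v) e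
  inc-pres⁻¹ g {v} {e} i =
    inc-refl g (actV (g ⁻¹) v) e (subst (λ u → Inc u (actE g e)) (sym (V.act-act-⁻¹ g v)) i)

module TwoOrbits {c ℓ : Level} (Γ : Graph) (μ : ℕ) (G : Group c ℓ) (A : AutAction Γ G)
  (no-isolated     : Graph.NoIsolatedVertices Γ)
  (multiplicity-μ  : Graph.ConstantEdgeMultiplicity Γ μ)
  (edge-transitive : AutAction.EdgeTransitive A)
  (α₁ α₂           : Fin (Graph.nV Γ))
  (α₂∉V₁           : ¬ AutAction.Orb A α₁ α₂)
  (two-orbits      : ∀ v → AutAction.Orb A α₁ v ⊎ AutAction.Orb A α₂ v) where
  open Graph Γ
  open Group G using (Carrier; _∙_; _⁻¹)
  open AutAction A
  open GraphProperties Γ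
  open Orbits A

  α : Fin nV
  α = α₁

  e₀ : Fin nE
  e₀ = proj₁ (no-isolated α)

  α-inc : Inc α e₀
  α-inc = proj₂ (no-isolated α)

  β : Fin nV
  β = proj₁ (other-end α-inc)

  β-inc : Inc β e₀
  β-inc = proj₁ (proj₂ (other-end α-inc))

  α≢β : α ≢ β
  α≢β = proj₁ (proj₂ (proj₂ (other-end α-inc)))

  e₀-ends : ∀ v → Inc v e₀ → v ≡ α ⊎ v ≡ β
  e₀-ends = proj₂ (proj₂ (proj₂ (other-end α-inc)))

  transporter : Fin nE → Carrier
  transporter e = proj₁ (edge-transitive e₀ e)

  transporter-moves : ∀ e → actE (transporter e) e₀ ≡ e
  transporter-moves e = proj₂ (edge-transitive e₀ e)

  ends-of-image : ∀ g {v} → Inc v (actE g e₀) → v ≡ actV g α ⊎ v ≡ actV g β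
  ends-of-image g {v} i = Sum.map translate translate (e₀-ends _ (inc-pres⁻¹ g i))
    where
      translate : ∀ {u} → actV (g ⁻¹) v ≡ u → v ≡ actV g u
      translate eq = trans (sym (V.act-act-⁻¹ g v)) (cong (actV g) eq)

  -- An edge at α₂ is some g e₀, so α₂ is g α or g β; only the latter escapes V₁.
  β∈V₂ : Orb α₂ β
  β∈V₂ with two-orbits β
  ... | inj₂ β∈V₂ = β∈V₂
  ... | inj₁ β∈V₁ = ⊥-elim (α₂∉V₁ (ends-in-V₁ (ends-of-image g α₂-inc)))
    where
      g : Carrier
      g = transporter (proj₁ (no-isolated α₂))

      α₂-inc : Inc α₂ (actE g e₀)
      α₂-inc = subst (Inc α₂) (sym (transporter-moves _)) (proj₂ (no-isolated α₂))

      ends-in-V₁ : ∀ {v} → v ≡ actV g α ⊎ v ≡ actV g β → Orb α v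
      ends-in-V₁ (inj₁ refl) = g , refl
      ends-in-V₁ (inj₂ refl) = orb-trans β∈V₁ (g , refl)

  orbit-of : ∀ v → Orb α v ⊎ Orb β v
  orbit-of v = Sum.map₂ (orb-trans (orb-sym β∈V₂)) (two-orbits v)

  orbits-disjoint : ∀ {v} → Orb α v → Orb β v → ⊥
  orbits-disjoint v∈V₁ v∈V₂ = α₂∉V₁ (orb-trans v∈V₁ (orb-sym (orb-trans β∈V₂ v∈V₂)))

  left right : Fin nE → Fin nV
  left  e = actV (transporter e) α
  right e = actV (transporter e) β

  left-inc : ∀ e → Inc (left e) e
  left-inc e = subst (Inc (left e)) (transporter-moves e) (inc-pres (transporter e) α e₀ α-inc)

  right-inc : ∀ e → Inc (right e) e
  right-inc e = subst (Inc (right e)) (transporter-moves e) (inc-pres (transporter e) β e₀ β-inc)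

  left≢right : ∀ e → left e ≢ right e
  left≢right e eq = orbits-disjoint (transporter e , refl) (transporter e , sym eq)

  left-joins-right : ∀ e → Joins (left e) (right e) e
  left-joins-right e = incident⇒joins (left-inc e) (right-inc e) (left≢right e)

  inc-left : ∀ {v} e → Orb α v → Inc v e → v ≡ left e
  inc-left e v∈V₁ i
    with ends-of-image (transporter e) (subst (Inc _) (sym (transporter-moves e)) i)
  ... | inj₁ v≡ = v≡
  ... | inj₂ v≡ = ⊥-elim (orbits-disjoint v∈V₁ (transporter e , sym v≡))

  inc-right : ∀ {v} e → Orb β v → Inc v e → v ≡ right e
  inc-right e v∈V₂ i
    with ends-of-image (transporter e) (subst (Inc _) (sym (transporter-moves e)) i)
  ... | inj₂ v≡ = v≡
  ... | inj₁ v≡ = ⊥-elim (orbits-disjoint (transporter e , sym v≡) v∈V₂)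

  inc⇒end : ∀ {v} e → Inc v e → v ≡ left e ⊎ v ≡ right e
  inc⇒end {v} e i = Sum.map (λ v∈V₁ → inc-left e v∈V₁ i) (λ v∈V₂ → inc-right e v∈V₂ i) (orbit-of v)

  left-image : ∀ g → left (actE g e₀) ≡ actV g α
  left-image g = sym (inc-left (actE g e₀) (g , refl) (inc-pres g α e₀ α-inc))

  right-image : ∀ g → right (actE g e₀) ≡ actV g β
  right-image g = sym (inc-right (actE g e₀) (g , refl) (inc-pres g β e₀ β-inc))

  cosetIndex : IndexInIntersection G (StabV α) (StabV β) (StabE e₀) μ
  cosetIndex = transporter ∘ parallel , fixes-ends , injective , onto
    where
      parallels : HasSize (Joins α β) μ
      parallels = joining-edges multiplicity-μ (e₀ , incident⇒joins α-inc β-inc α≢β)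

      parallel : Fin μ → Fin nE
      parallel = proj₁ parallels

      parallel-joins : ∀ i → Joins α β (parallel i)
      parallel-joins = proj₁ (proj₂ parallels)

      parallel-injective : ∀ i j → parallel i ≡ parallel j → i ≡ j
      parallel-injective = proj₁ (proj₂ (proj₂ parallels))

      fixes-ends : ∀ i → StabV α (transporter (parallel i)) × StabV β (transporter (parallel i))
      fixes-ends i = sym (inc-left  _ (orb-refl α) (joins⇒incˡ (parallel-joins i))) ,
                     sym (inc-right _ (orb-refl β) (joins⇒incʳ (parallel-joins i)))

      injective : ∀ i j → StabE e₀ (transporter (parallel i) ∙ transporter (parallel j) ⁻¹) → i ≡ j
      injective i j fixes = parallel-injective i j (begin
        parallel i                           ≡⟨ transporter-moves _ ⟨
        actE (transporter (parallel i)) e₀   ≡⟨ E.fixes⇒agree _ _ e₀ fixes ⟩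
        actE (transporter (parallel j)) e₀   ≡⟨ transporter-moves _ ⟩
        parallel j                           ∎)
        where open ≡-Reasoning

      onto : ∀ g → StabV α g → StabV β g → ∃[ k ] StabE e₀ (g ∙ transporter (parallel k) ⁻¹)
      onto g gα≡α gβ≡β = k , E.agree⇒fixes g _ e₀ (sym (trans (transporter-moves _) parallel-k≡))
        where
          joins : Joins α β (actE g e₀)
          joins = incident⇒joins (subst (λ u → Inc u (actE g e₀)) gα≡α (inc-pres g α e₀ α-inc))
                                 (subst (λ u → Inc u (actE g e₀)) gβ≡β (inc-pres g β e₀ β-inc)) α≢β
          k : Fin μ
          k = proj₁ (proj₂ (proj₂ (proj₂ parallels)) _ joins)
          parallel-k≡ : parallel k ≡ actE g e₀
          parallel-k≡ = proj₂ (proj₂ (proj₂ (proj₂ parallels)) _ joins)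

  ≅BiCos : Γ ≅ BiCos G (StabV α) (StabV β) (StabE e₀)
  ≅BiCos = record
    { fV      = λ v → coset v (orbit-of v)
    ; fE      = transporter
    ; fV-inj  = λ u v → coset-injective u v (orbit-of u) (orbit-of v)
    ; fE-inj  = λ e e′ (lift fixes) →
        trans (sym (transporter-moves e)) (trans (E.fixes⇒agree _ _ e₀ fixes) (transporter-moves e′))
    ; fV-surj = λ { (inj₁ x) → actV x α , coset-onto₁ x (orbit-of (actV x α))
                  ; (inj₂ x) → actV x β , coset-onto₂ x (orbit-of (actV x β)) }
    ; fE-surj = λ g → actE g e₀ , lift (E.agree⇒fixes _ g e₀ (transporter-moves (actE g e₀)))
    ; inc→    = λ v e → coset-inc v e (orbit-of v)
    ; inc←    = λ v e → coset-inc⁻¹ v e (orbit-of v)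
    }
    where
      module S = SGraph (BiCos G (StabV α) (StabV β) (StabE e₀))

      coset : ∀ v → Orb α v ⊎ Orb β v → Carrier ⊎ Carrier
      coset v = Sum.map proj₁ proj₁

      coset-injective : ∀ u v (p : Orb α u ⊎ Orb β u) (q : Orb α v ⊎ Orb β v) →
                        coset u p S.≈V coset v q → u ≡ v
      coset-injective _ _ (inj₁ (x , refl)) (inj₁ (y , refl)) (lift fixes) = V.fixes⇒agree x y α fixes
      coset-injective _ _ (inj₂ (x , refl)) (inj₂ (y , refl)) (lift fixes) = V.fixes⇒agree x y β fixes
      coset-injective _ _ (inj₁ _) (inj₂ _) (lift ())
      coset-injective _ _ (inj₂ _) (inj₁ _) (lift ())

      coset-onto₁ : ∀ x (p : Orb α (actV x α) ⊎ Orb β (actV x α)) → coset _ p S.≈V inj₁ x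
      coset-onto₁ x (inj₁ (y , agree)) = lift (V.agree⇒fixes y x α agree)
      coset-onto₁ x (inj₂ x∈V₂)        = ⊥-elim (orbits-disjoint (x , refl) x∈V₂)

      coset-onto₂ : ∀ x (p : Orb α (actV x β) ⊎ Orb β (actV x β)) → coset _ p S.≈V inj₂ x
      coset-onto₂ x (inj₂ (y , agree)) = lift (V.agree⇒fixes y x β agree)
      coset-onto₂ x (inj₁ x∈V₁)        = ⊥-elim (orbits-disjoint x∈V₁ (x , refl))

      coset-inc : ∀ v e (p : Orb α v ⊎ Orb β v) → Inc v e → S.Inc (coset v p) (transporter e)
      coset-inc v e (inj₁ (x , agree)) i = lift (transporter e ,
        V.agree⇒fixes _ x α (trans (sym (inc-left e (x , agree) i)) (sym agree)) ,
        E.agree⇒fixes _ _ e₀ refl)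
      coset-inc v e (inj₂ (x , agree)) i = lift (transporter e ,
        V.agree⇒fixes _ x β (trans (sym (inc-right e (x , agree) i)) (sym agree)) ,
        E.agree⇒fixes _ _ e₀ refl)

      coset-inc⁻¹ : ∀ v e (p : Orb α v ⊎ Orb β v) → S.Inc (coset v p) (transporter e) → Inc v e
      coset-inc⁻¹ v e (inj₁ (x , agree)) (lift (g , gα , ge)) =
        subst₂ Inc (trans (V.fixes⇒agree g x α gα) agree)
                   (trans (E.fixes⇒agree g _ e₀ ge) (transporter-moves e))
                   (inc-pres g α e₀ α-inc)
      coset-inc⁻¹ v e (inj₂ (x , agree)) (lift (g , gβ , ge)) =
        subst₂ Inc (trans (V.fixes⇒agree g x β gβ) agree)
                   (trans (E.fixes⇒agree g _ e₀ ge) (transporter-moves e))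
                   (inc-pres g β e₀ β-inc)

  SameStabilisers : Set c
  SameStabilisers = (∀ g → StabV α g → StabV β g) × (∀ g → StabV β g → StabV α g)

  -- g fixes α (resp. β) iff the edge g e₀ has α as its left (resp. β as its right) end,
  -- so equality of the stabilisers is a finite check over the edges.
  sameStabilisers? : Dec SameStabilisers
  sameStabilisers? = map′ from-edges to-edges (all? balanced?)
    where
      Balanced : Fin nE → Set
      Balanced e = (left e ≡ α → right e ≡ β) × (right e ≡ β → left e ≡ α)

      balanced? : Decidable Balanced
      balanced? e = ((left e ≟ α) →-dec (right e ≟ β)) ×-dec ((right e ≟ β) →-dec (left e ≟ α))

      to-edges : SameStabilisers → ∀ e → Balanced e
      to-edges (α⇒β , β⇒α) e = α⇒β (transporter e) , β⇒α (transporter e)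

      from-edges : (∀ e → Balanced e) → SameStabilisers
      from-edges balanced =
        (λ g gα≡α → trans (sym (right-image g)) (proj₁ (balanced _) (trans (left-image g) gα≡α))) ,
        (λ g gβ≡β → trans (sym (left-image g)) (proj₂ (balanced _) (trans (right-image g) gβ≡β)))

  module Paired (same : SameStabilisers) where

    left≡⇒right≡ : ∀ {e e′} → left e ≡ left e′ → right e ≡ right e′
    left≡⇒right≡ eq = V.fixes⇒agree _ _ β (proj₁ same _ (V.agree⇒fixes _ _ α eq))

    right≡⇒left≡ : ∀ {e e′} → right e ≡ right e′ → left e ≡ left e′
    right≡⇒left≡ eq = V.fixes⇒agree _ _ α (proj₂ same _ (V.agree⇒fixes _ _ β eq))

    in-V₁? : Decidable (Orb α)
    in-V₁? v with orbit-of v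
    ... | inj₁ v∈V₁ = yes v∈V₁
    ... | inj₂ v∈V₂ = no λ v∈V₁ → orbits-disjoint v∈V₁ v∈V₂

    r : ℕ
    r = length (filter in-V₁? (List.allFin nV))

    V₁-size : HasSize (Orb α) r
    V₁-size = hasSize-filter in-V₁?

    enumV₁ : Fin r → Fin nV
    enumV₁ = proj₁ V₁-size

    enumV₁-injective : ∀ i j → enumV₁ i ≡ enumV₁ j → i ≡ j
    enumV₁-injective = proj₁ (proj₂ (proj₂ V₁-size))

    indexV₁ : ∀ v → Orb α v → Fin r
    indexV₁ v v∈V₁ = proj₁ (proj₂ (proj₂ (proj₂ V₁-size)) v v∈V₁)

    enumV₁-indexV₁ : ∀ v v∈V₁ → enumV₁ (indexV₁ v v∈V₁) ≡ v
    enumV₁-indexV₁ v v∈V₁ = proj₂ (proj₂ (proj₂ (proj₂ V₁-size)) v v∈V₁)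

    -- Components of Γ are indexed by V₁ through their left ends.
    edgeClass : Fin nE → Fin r
    edgeClass e = indexV₁ (left e) (transporter e , refl)

    vertexClass : Fin nV → Fin r
    vertexClass v = edgeClass (proj₁ (no-isolated v))

    edgeClass≡⇒left≡ : ∀ {e e′} → edgeClass e ≡ edgeClass e′ → left e ≡ left e′
    edgeClass≡⇒left≡ eq = trans (sym (enumV₁-indexV₁ _ _)) (trans (cong enumV₁ eq) (enumV₁-indexV₁ _ _))

    left≡⇒edgeClass≡ : ∀ {e e′} → left e ≡ left e′ → edgeClass e ≡ edgeClass e′
    left≡⇒edgeClass≡ eq =
      enumV₁-injective _ _ (trans (enumV₁-indexV₁ _ _) (trans eq (sym (enumV₁-indexV₁ _ _))))

    inc⇒left≡ : ∀ {v e e′} → Inc v e → Inc v e′ → left e ≡ left e′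
    inc⇒left≡ {v} {e} {e′} i i′ with orbit-of v
    ... | inj₁ v∈V₁ = trans (sym (inc-left e v∈V₁ i)) (inc-left e′ v∈V₁ i′)
    ... | inj₂ v∈V₂ = right≡⇒left≡ (trans (sym (inc-right e v∈V₂ i)) (inc-right e′ v∈V₂ i′))

    left≡⇒inc : ∀ {v e e′} → left e ≡ left e′ → Inc v e → Inc v e′
    left≡⇒inc {e′ = e′} eq i with inc⇒end _ i
    ... | inj₁ refl = subst (λ u → Inc u e′) (sym eq) (left-inc e′)
    ... | inj₂ refl = subst (λ u → Inc u e′) (sym (left≡⇒right≡ eq)) (right-inc e′)

    inc⇒sameClass : ∀ {v e} → Inc v e → vertexClass v ≡ edgeClass e
    inc⇒sameClass {v} i = left≡⇒edgeClass≡ (inc⇒left≡ (proj₂ (no-isolated v)) i)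

    sameClass⇒inc : ∀ {v e} → vertexClass v ≡ edgeClass e → Inc v e
    sameClass⇒inc {v} eq = left≡⇒inc (edgeClass≡⇒left≡ eq) (proj₂ (no-isolated v))

    rung : Fin r → Fin nE
    rung i = proj₁ (no-isolated (enumV₁ i))

    rung-class : ∀ i → edgeClass (rung i) ≡ i
    rung-class i = enumV₁-injective _ _ (trans (enumV₁-indexV₁ _ _)
      (sym (inc-left (rung i) (proj₁ (proj₂ V₁-size) i) (proj₂ (no-isolated (enumV₁ i))))))

    inc-rung⇒class : ∀ {v i} → Inc v (rung i) → vertexClass v ≡ i
    inc-rung⇒class {i = i} inc = trans (inc⇒sameClass inc) (rung-class i)

    class⇒inc-rung : ∀ {v i} → vertexClass v ≡ i → Inc v (rung i)
    class⇒inc-rung {i = i} eq = sameClass⇒inc (trans eq (sym (rung-class i)))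

    vertex-fibre : ∀ i → HasSize (λ v → vertexClass v ≡ i) 2
    vertex-fibre i = end , (λ k → inc-rung⇒class (end-inc k)) , end-injective , end-onto
      where
        end : Fin 2 → Fin nV
        end zero       = left (rung i)
        end (suc zero) = right (rung i)

        end-inc : ∀ k → Inc (end k) (rung i)
        end-inc zero       = left-inc (rung i)
        end-inc (suc zero) = right-inc (rung i)

        end-injective : ∀ k l → end k ≡ end l → k ≡ l
        end-injective zero       zero       _  = refl
        end-injective zero       (suc zero) eq = ⊥-elim (left≢right (rung i) eq)
        end-injective (suc zero) zero       eq = ⊥-elim (left≢right (rung i) (sym eq))
        end-injective (suc zero) (suc zero) _  = refl

        end-onto : ∀ v → vertexClass v ≡ i → ∃[ k ] end k ≡ v
        end-onto v eq with inc⇒end (rung i) (class⇒inc-rung eq)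
        ... | inj₁ v≡ = zero , sym v≡
        ... | inj₂ v≡ = suc zero , sym v≡

    edge-fibre : ∀ i → HasSize (λ e → edgeClass e ≡ i) μ
    edge-fibre i = hasSize-⇔ joins⇒class class⇒joins
      (joining-edges multiplicity-μ (rung i , left-joins-right (rung i)))
      where
        joins⇒class : ∀ e → Joins (left (rung i)) (right (rung i)) e → edgeClass e ≡ i
        joins⇒class e joins = trans
          (left≡⇒edgeClass≡ (sym (inc-left e (transporter (rung i) , refl) (joins⇒incˡ joins))))
          (rung-class i)

        class⇒joins : ∀ e → edgeClass e ≡ i → Joins (left (rung i)) (right (rung i)) e
        class⇒joins e eq = subst₂ (λ u w → Joins u w e) same-left (left≡⇒right≡ same-left)
                                  (left-joins-right e)
          where
            same-left : left e ≡ left (rung i)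
            same-left = edgeClass≡⇒left≡ (trans eq (sym (rung-class i)))

    V₂-size : HasSize (Orb α₂) r
    V₂-size = hasSize-section (right ∘ rung) vertexClass
      (λ i → orb-trans β∈V₂ (transporter (rung i) , refl))
      (λ i → inc-rung⇒class (right-inc (rung i)))
      (λ v v∈V₂ → sym (inc-right _ (orb-trans (orb-sym β∈V₂) v∈V₂) (class⇒inc-rung refl)))

    ≅rK2 : Γ ≅ rK2 r μ
    ≅rK2 = record
      { fV      = Vc.coord
      ; fE      = Ec.coord
      ; fV-inj  = Vc.coord-injective
      ; fE-inj  = Ec.coord-injective
      ; fV-surj = Vc.coord-surjective
      ; fE-surj = Ec.coord-surjective
      ; inc→    = λ v e i → trans (Vc.coord-fibre v) (trans (inc⇒sameClass i) (sym (Ec.coord-fibre e)))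
      ; inc←    = λ v e eq → sameClass⇒inc (trans (sym (Vc.coord-fibre v)) (trans eq (Ec.coord-fibre e)))
      }
      where
        module Vc = ProductCoordinates (fibres⇒product vertexClass vertex-fibre)
        module Ec = ProductCoordinates (fibres⇒product edgeClass edge-fibre)

proposition5p3 :
    ∀ {c ℓ : Level} (Γ : Graph) (μ : ℕ) (G : Group c ℓ) (A : AutAction Γ G) →
    Graph.NoIsolatedVertices Γ →
    Graph.ConstantEdgeMultiplicity Γ μ →
    AutAction.EdgeTransitive A →
    (α₁ α₂ : Fin (Graph.nV Γ)) →
    ¬ AutAction.Orb A α₁ α₂ →
    (∀ v → AutAction.Orb A α₁ v ⊎ AutAction.Orb A α₂ v) →
    (Σ (Fin (Graph.nE Γ)) λ e → Σ (Fin (Graph.nV Γ)) λ α → Σ (Fin (Graph.nV Γ)) λ β →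
        Graph.Inc Γ α e × Graph.Inc Γ β e × α ≢ β
        × ¬ ((∀ g → AutAction.StabV A α g → AutAction.StabV A β g)
             × (∀ g → AutAction.StabV A β g → AutAction.StabV A α g))
        × IndexInIntersection G (AutAction.StabV A α) (AutAction.StabV A β) (AutAction.StabE A e) μ
        × (Γ ≅ BiCos G (AutAction.StabV A α) (AutAction.StabV A β) (AutAction.StabE A e)))
    ⊎ (∃[ r ] HasSize (AutAction.Orb A α₁) r × HasSize (AutAction.Orb A α₂) r × (Γ ≅ rK2 r μ))
proposition5p3 Γ μ G A no-isolated multiplicity-μ edge-transitive α₁ α₂ α₂∉V₁ two-orbits =
  case sameStabilisers? of λ where
    (yes same) → let open Paired same in inj₂ (r , V₁-size , V₂-size , ≅rK2)
    (no ¬same) → inj₁ (e₀ , α , β , α-inc , β-inc , α≢β , ¬same , cosetIndex , ≅BiCos)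
  where open TwoOrbits Γ μ G A no-isolated multiplicity-μ edge-transitive α₁ α₂ α₂∉V₁ two-orbits
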